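{- For all positive integers $n$, the numbers $a_n=\sum_{k=1}^{n}(-1)^{k-1}(k-1)!\,c(n,k)$ satisfy $$(n-1)!-a_n=\sum_{k=1}^{n-1}\binom{n-1}{k-1}(n-k-1)!\,a_k.$$
   Context: $c(n,k)$ denotes the (unsigned) Stirling number of the first kind: the number of permutations of $\{1,\dots,n\}$ with exactly $k$ cycles. -}

module Defs where

open import Data.Nat using (ℕ; zero; suc; _+_; _*_; _∸_; _≤ᵇ_; _≡ᵇ_; _!)
open import Data.Nat.Combinatorics using (_C_)
open import Data.Bool using (Bool; true; false; _∧_; _∨_; not; if_then_else_)
open import Data.Fin using (Fin; toℕ)
open import Data.Integer as ℤ using (ℤ; +_)
open import Data.List using (List; []; _∷_; map; concatMap; length; allFin; upTo)
open import Data.Bool.ListAction using (and)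
open import Data.List as List using (filterᵇ)

allᵇ : ∀ {A : Set} → (A → Bool) → List A → Bool
allᵇ p xs = and (map p xs)

allFuns : (n m : ℕ) → List (Fin n → Fin m)
allFuns zero m = (λ ()) ∷ []
allFuns (suc n) m =
  concatMap (λ x → map (λ f → λ { Fin.zero → x ; (Fin.suc i) → f i }) (allFuns n m)) (allFin m)

_=ᶠ_ : ∀ {n} → Fin n → Fin n → Bool
i =ᶠ j = toℕ i ≡ᵇ toℕ j

-- injective endofunction of a finite set = permutation
isPermᵇ : ∀ {n} → (Fin n → Fin n) → Bool
isPermᵇ {n} f = allᵇ (λ i → allᵇ (λ j → not (f i =ᶠ f j) ∨ (i =ᶠ j)) (allFin n)) (allFin n)

perms : (n : ℕ) → List (Fin n → Fin n)
perms n = filterᵇ isPermᵇ (allFuns n n)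

iter : ∀ {n} → (Fin n → Fin n) → ℕ → Fin n → Fin n
iter f zero i = i
iter f (suc j) i = f (iter f j i)

-- i is the least element of its cycle (the orbit {f^j i | j < n} is the whole cycle)
isCycleMinᵇ : ∀ {n} → (Fin n → Fin n) → Fin n → Bool
isCycleMinᵇ {n} f i = allᵇ (λ j → toℕ i ≤ᵇ toℕ (iter f j i)) (upTo n)

-- number of cycles = number of cycles' least elements
numCycles : ∀ {n} → (Fin n → Fin n) → ℕ
numCycles {n} f = length (filterᵇ (isCycleMinᵇ f) (allFin n))

c : ℕ → ℕ → ℕ
c n k = length (filterᵇ (λ f → numCycles f ≡ᵇ k) (perms n))

-- Finite sums  Σ_{k=lo}^{hi} f k  (empty if hi < lo)

Σ[_⋯_] : ℕ → ℕ → (ℕ → ℤ) → ℤ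
Σ[ lo ⋯ hi ] f = List.foldr ℤ._+_ (+ 0) (map (λ i → f (lo + i)) (upTo (suc hi ∸ lo)))

sign : ℕ → ℤ
sign zero = + 1
sign (suc m) = ℤ.- sign m

a : ℕ → ℤ
a n = Σ[ 1 ⋯ n ] (λ k → sign (k ∸ 1) ℤ.* + ((k ∸ 1) !) ℤ.* + c n k)

{-# OPTIONS --safe #-}

-- Inserting a new
-- largest element into a permutation σ of n elements, right after some p on its cycle or
-- as a new fixed point, is a bijection from such pairs (σ, p) onto the permutations of
-- n + 1 elements, and it adds a cycle exactly in the fixed-point case; hence
-- c(n+1,k) = n c(n,k) + c(n,k-1). By induction on m this recurrence gives
--   k c(m+1,k+1) = ∑_{t<m} C(m,t) (m-t-1)! c(t+1,k).
-- In a_{m+1} the term k = 1 is c(m+1,1) = m!, and the identity turns each remaining term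
-- (-1)^k k! c(m+1,k+1) into -(-1)^(k-1) (k-1)! ∑_t C(m,t) (m-t-1)! c(t+1,k); exchanging
-- the two sums leaves ∑_t C(m,t) (m-t-1)! a_{t+1}.

module Submission where

open import Defs
import Algebra.Properties.CommutativeSemigroup as CommSemigroupProperties
import Algebra.Properties.Semiring.Sum as SemiringSum
open import Data.Bool using (Bool; true; false; _∧_; _∨_; not; if_then_else_; T)
open import Data.Bool.Properties using (T-∧)
open import Data.Empty using (⊥-elim)
open import Data.Fin as Fin using (Fin; toℕ; fromℕ; inject₁; punchOut)
open import Data.Fin.Properties as Fin
  using (toℕ-injective; toℕ-inject₁; toℕ-fromℕ; toℕ<n; fromℕ≢inject₁; inject₁-injective; injective⇒≤; punchOut-injective)
open import Data.Fin.Relation.Unary.Top using (view; ‵fromℕ; ‵inject₁; view-fromℕ; view-inject₁)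
open import Data.Integer as ℤ using (ℤ)
import Data.Integer.Properties as ℤ
import Data.Integer.Tactic.RingSolver as ℤ-Solver
open import Data.List
  using (List; []; _∷_; map; foldr; _++_; concatMap; applyUpTo; upTo; length; allFin; tabulate; filterᵇ; cartesianProduct)
open import Data.List.Properties using (map-upTo)
open import Data.List.Relation.Unary.All.Properties using (all⁺; all⁻; tabulate⁺; tabulate⁻; applyUpTo⁺₁; applyUpTo⁻)
open import Data.Nat
  using (ℕ; zero; suc; _+_; _*_; _∸_; _!; _<_; _≤_; _≡ᵇ_; _<?_; z≤n; s≤s; s<s; s≤s⁻¹; >-nonZero)
open import Data.Nat.Combinatorics using (_C_; nCk+nC[k+1]≡[n+1]C[k+1]; nCn≡1)
open import Data.Nat.Induction using (<-rec)
open import Data.Nat.Properties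
open import Data.Nat.Tactic.RingSolver using (solve-∀)
open import Data.Product using (∃; _×_; _,_; proj₁; proj₂)
open import Data.Sum using (_⊎_; inj₁; inj₂)
open import Function using (_∘_; id; _⇔_; mk⇔; Equivalence)
open import Function.Definitions using (Injective; Congruent)
open import Relation.Binary.PropositionalEquality
open import Relation.Nullary using (¬_; yes; no)
open ≡-Reasoning

open CommSemigroupProperties +-commutativeSemigroup
  using () renaming (interchange to +-interchange; x∙yz≈y∙xz to x+[y+z]≡y+[x+z]; x∙yz≈xz∙y to x+[y+z]≡x+z+y)
open CommSemigroupProperties *-commutativeSemigroup
  using () renaming (x∙yz≈y∙xz to x*[y*z]≡y*[x*z]; x∙yz≈yx∙z to x*[y*z]≡y*x*z)
open SemiringSum +-*-semiring
module ℤΣ = SemiringSum ℤ.+-*-semiring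

private variable
  A B : Set
  n m k : ℕ

𝟙 : Bool → ℕ
𝟙 true  = 1
𝟙 false = 0

𝟙-∧ : ∀ a b → 𝟙 (a ∧ b) ≡ 𝟙 a * 𝟙 b
𝟙-∧ true  b = sym (+-identityʳ (𝟙 b))
𝟙-∧ false b = refl

𝟙-cong : ∀ {a b} → (T a ⇔ T b) → 𝟙 a ≡ 𝟙 b
𝟙-cong {true}  {true}  _   = refl
𝟙-cong {true}  {false} a⇔b = ⊥-elim (Equivalence.to a⇔b _)
𝟙-cong {false} {true}  a⇔b = ⊥-elim (Equivalence.from a⇔b _)
𝟙-cong {false} {false} _   = refl

𝟙*-cong : ∀ b {x y} → (T b → x ≡ y) → 𝟙 b * x ≡ 𝟙 b * y
𝟙*-cong true  x≡y = cong (_+ 0) (x≡y _)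
𝟙*-cong false _   = refl

𝟙-T : ∀ {b} → T b → 𝟙 b ≡ 1
𝟙-T {true} _ = refl

𝟙-¬T : ∀ {b} → ¬ T b → 𝟙 b ≡ 0
𝟙-¬T {true}  ¬b = ⊥-elim (¬b _)
𝟙-¬T {false} _  = refl

𝟙-guarded-*-identityˡ : ∀ b {x} y → (T b → x ≡ 1) → x * (𝟙 b * y) ≡ 𝟙 b * y
𝟙-guarded-*-identityˡ true  {x} y x≡1 = trans (cong (_* (y + 0)) (x≡1 _)) (*-identityˡ (y + 0))
𝟙-guarded-*-identityˡ false {x} y _   = *-zeroʳ x

if-T : ∀ {b} {x y : A} → T b → (if b then x else y) ≡ x
if-T {b = true} _ = refl

if-¬T : ∀ {b} {x y : A} → ¬ T b → (if b then x else y) ≡ y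
if-¬T {b = true}  ¬b = ⊥-elim (¬b _)
if-¬T {b = false} _  = refl

T-not-∨⇒→ : ∀ b {c} → T (not b ∨ c) → T b → T c
T-not-∨⇒→ true t _ = t

→⇒T-not-∨ : ∀ b {c} → (T b → T c) → T (not b ∨ c)
→⇒T-not-∨ true  h = h _
→⇒T-not-∨ false h = _

∑ˡ : List A → (A → ℕ) → ℕ
∑ˡ []       f = 0
∑ˡ (x ∷ xs) f = f x + ∑ˡ xs f

syntax ∑ˡ xs (λ x → e) = ∑[ x ∈ xs ] e

∑ˡ-cong : ∀ (xs : List A) {f g : A → ℕ} → f ≗ g → ∑ˡ xs f ≡ ∑ˡ xs g
∑ˡ-cong []       f≗g = refl
∑ˡ-cong (x ∷ xs) f≗g = cong₂ _+_ (f≗g x) (∑ˡ-cong xs f≗g)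

∑ˡ-zero : ∀ (xs : List A) → ∑[ x ∈ xs ] 0 ≡ 0
∑ˡ-zero []       = refl
∑ˡ-zero (x ∷ xs) = ∑ˡ-zero xs

∑ˡ-++ : ∀ (xs ys : List A) f → ∑ˡ (xs ++ ys) f ≡ ∑ˡ xs f + ∑ˡ ys f
∑ˡ-++ []       ys f = refl
∑ˡ-++ (x ∷ xs) ys f = trans (cong (f x +_) (∑ˡ-++ xs ys f)) (sym (+-assoc (f x) _ _))

∑ˡ-distrib-+ : ∀ (xs : List A) f g → ∑[ x ∈ xs ] (f x + g x) ≡ ∑ˡ xs f + ∑ˡ xs g
∑ˡ-distrib-+ []       f g = refl
∑ˡ-distrib-+ (x ∷ xs) f g =
  trans (cong (f x + g x +_) (∑ˡ-distrib-+ xs f g)) (+-interchange (f x) (g x) _ _)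

*-distribˡ-∑ˡ : ∀ k (xs : List A) f → k * ∑ˡ xs f ≡ ∑[ x ∈ xs ] (k * f x)
*-distribˡ-∑ˡ k []       f = *-zeroʳ k
*-distribˡ-∑ˡ k (x ∷ xs) f = trans (*-distribˡ-+ k (f x) _) (cong (k * f x +_) (*-distribˡ-∑ˡ k xs f))

*-distribʳ-∑ˡ : ∀ k (xs : List A) f → ∑ˡ xs f * k ≡ ∑[ x ∈ xs ] (f x * k)
*-distribʳ-∑ˡ k xs f = begin
  ∑ˡ xs f * k               ≡⟨ *-comm (∑ˡ xs f) k ⟩
  k * ∑ˡ xs f               ≡⟨ *-distribˡ-∑ˡ k xs f ⟩
  ∑[ x ∈ xs ] (k * f x)     ≡⟨ ∑ˡ-cong xs (λ x → *-comm k (f x)) ⟩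
  ∑[ x ∈ xs ] (f x * k)     ∎

length-filterᵇ : ∀ (p : A → Bool) xs → length (filterᵇ p xs) ≡ ∑[ x ∈ xs ] 𝟙 (p x)
length-filterᵇ p []       = refl
length-filterᵇ p (x ∷ xs) with p x
... | true  = cong suc (length-filterᵇ p xs)
... | false = length-filterᵇ p xs

∑ˡ-filterᵇ : ∀ (p : A → Bool) xs f → ∑ˡ (filterᵇ p xs) f ≡ ∑[ x ∈ xs ] (𝟙 (p x) * f x)
∑ˡ-filterᵇ p []       f = refl
∑ˡ-filterᵇ p (x ∷ xs) f with p x
... | true  = cong₂ _+_ (sym (+-identityʳ (f x))) (∑ˡ-filterᵇ p xs f)
... | false = ∑ˡ-filterᵇ p xs f

∑ˡ-tabulate : ∀ (g : Fin n → A) f → ∑ˡ (tabulate g) f ≡ ∑[ i < n ] f (g i)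
∑ˡ-tabulate {zero}  g f = refl
∑ˡ-tabulate {suc n} g f = cong (f (g Fin.zero) +_) (∑ˡ-tabulate (g ∘ Fin.suc) f)

∑ˡ-allFin : ∀ n (f : Fin n → ℕ) → ∑ˡ (allFin n) f ≡ ∑[ i < n ] f i
∑ˡ-allFin n = ∑ˡ-tabulate id

∑ˡ-map : ∀ (h : A → B) xs f → ∑ˡ (map h xs) f ≡ ∑ˡ xs (f ∘ h)
∑ˡ-map h []       f = refl
∑ˡ-map h (x ∷ xs) f = cong (f (h x) +_) (∑ˡ-map h xs f)

∑ˡ-concatMap : ∀ (h : A → List B) xs f → ∑ˡ (concatMap h xs) f ≡ ∑[ x ∈ xs ] ∑ˡ (h x) f
∑ˡ-concatMap h []       f = refl
∑ˡ-concatMap h (x ∷ xs) f = trans (∑ˡ-++ (h x) _ f) (cong (∑ˡ (h x) f +_) (∑ˡ-concatMap h xs f))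

∑ˡ-cartesianProduct : ∀ xs ys (f : A × B → ℕ) →
                      ∑ˡ (cartesianProduct xs ys) f ≡ ∑[ x ∈ xs ] ∑[ y ∈ ys ] f (x , y)
∑ˡ-cartesianProduct []       ys f = refl
∑ˡ-cartesianProduct (x ∷ xs) ys f = begin
  ∑ˡ (map (x ,_) ys ++ cartesianProduct xs ys) f
    ≡⟨ ∑ˡ-++ (map (x ,_) ys) _ f ⟩
  ∑ˡ (map (x ,_) ys) f + ∑ˡ (cartesianProduct xs ys) f
    ≡⟨ cong₂ _+_ (∑ˡ-map (x ,_) ys f) (∑ˡ-cartesianProduct xs ys f) ⟩
  ∑[ y ∈ ys ] f (x , y) + ∑[ x ∈ xs ] ∑[ y ∈ ys ] f (x , y) ∎

∑ˡ-comm : ∀ xs ys (f : A → B → ℕ) → ∑[ x ∈ xs ] ∑[ y ∈ ys ] f x y ≡ ∑[ y ∈ ys ] ∑[ x ∈ xs ] f x y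
∑ˡ-comm []       ys f = sym (∑ˡ-zero ys)
∑ˡ-comm (x ∷ xs) ys f =
  trans (cong (∑ˡ ys (f x) +_) (∑ˡ-comm xs ys f)) (sym (∑ˡ-distrib-+ ys (f x) _))

∑-const : ∀ n x → ∑[ i < n ] x ≡ n * x
∑-const zero    x = refl
∑-const (suc n) x = cong (x +_) (∑-const n x)

∑-toℕ-last : ∀ m (f : ℕ → ℕ) → ∑[ t < suc m ] f (toℕ t) ≡ ∑[ t < m ] f (toℕ t) + f m
∑-toℕ-last m f = begin
  ∑[ t < suc m ] f (toℕ t)
    ≡⟨ sum-init-last {n = m} (f ∘ toℕ) ⟩
  ∑[ t < m ] f (toℕ (inject₁ t)) + f (toℕ (fromℕ m))
    ≡⟨ cong₂ _+_ (sum-cong-≗ {m} (cong f ∘ toℕ-inject₁)) (cong f (toℕ-fromℕ m)) ⟩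
  ∑[ t < m ] f (toℕ t) + f m ∎

=ᶠ⇒≡ : ∀ {i j : Fin n} → T (i =ᶠ j) → i ≡ j
=ᶠ⇒≡ {i = i} {j} i=j = toℕ-injective (≡ᵇ⇒≡ (toℕ i) (toℕ j) i=j)

≡⇒=ᶠ : ∀ {i j : Fin n} → i ≡ j → T (i =ᶠ j)
≡⇒=ᶠ {i = i} refl = ≡⇒≡ᵇ (toℕ i) (toℕ i) refl

inject₁≢fromℕ : ∀ {i : Fin n} → inject₁ i ≢ fromℕ n
inject₁≢fromℕ = fromℕ≢inject₁ ∘ sym

fromℕ-or-inject₁ : ∀ (x : Fin (suc n)) → x ≡ fromℕ n ⊎ ∃ λ i → x ≡ inject₁ i
fromℕ-or-inject₁ x with view x
... | ‵fromℕ     = inj₁ refl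
... | ‵inject₁ i = inj₂ (i , refl)

∑-delta : ∀ (j : Fin n) → ∑[ i < n ] 𝟙 (j =ᶠ i) ≡ 1
∑-delta {suc n} Fin.zero    = cong suc (sum-replicate-zero n)
∑-delta {suc n} (Fin.suc j) = ∑-delta j

∑-split-fromℕ : ∀ n (g : ℕ → ℕ) → ∑[ p ∈ allFin (suc n) ] g (𝟙 (p =ᶠ fromℕ n)) ≡ n * g 0 + g 1
∑-split-fromℕ n g = begin
  ∑[ p ∈ allFin (suc n) ] g (𝟙 (p =ᶠ fromℕ n))                           ≡⟨ ∑ˡ-allFin (suc n) _ ⟩
  ∑[ p < suc n ] g (𝟙 (p =ᶠ fromℕ n))                                     ≡⟨ sum-init-last (λ p → g (𝟙 (p =ᶠ fromℕ n))) ⟩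
  ∑[ i < n ] g (𝟙 (inject₁ i =ᶠ fromℕ n)) + g (𝟙 (fromℕ n =ᶠ fromℕ n))
    ≡⟨ cong₂ _+_ (sum-cong-≗ (λ i → cong g (𝟙-¬T (inject₁≢fromℕ ∘ =ᶠ⇒≡ {i = inject₁ i} {j = fromℕ n}))))
                 (cong g (𝟙-T (≡⇒=ᶠ {i = fromℕ n} refl))) ⟩
  ∑[ i < n ] g 0 + g 1                                                    ≡⟨ cong (_+ g 1) (∑-const n (g 0)) ⟩
  n * g 0 + g 1                                                           ∎

-- Counting functions between finite sets

_≗ᵇ_ : (f g : Fin n → Fin m) → Bool
_≗ᵇ_ {zero}  f g = true
_≗ᵇ_ {suc n} f g = (f Fin.zero =ᶠ g Fin.zero) ∧ ((f ∘ Fin.suc) ≗ᵇ (g ∘ Fin.suc))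

≗ᵇ⇒≗ : ∀ {f g : Fin n → Fin m} → T (f ≗ᵇ g) → f ≗ g
≗ᵇ⇒≗ {suc n} {f = f} {g} f≗g Fin.zero    = =ᶠ⇒≡ (proj₁ (Equivalence.to (T-∧ {f Fin.zero =ᶠ g Fin.zero}) f≗g))
≗ᵇ⇒≗ {suc n} {f = f} {g} f≗g (Fin.suc i) = ≗ᵇ⇒≗ (proj₂ (Equivalence.to (T-∧ {f Fin.zero =ᶠ g Fin.zero}) f≗g)) i

≗⇒≗ᵇ : ∀ {f g : Fin n → Fin m} → f ≗ g → T (f ≗ᵇ g)
≗⇒≗ᵇ {zero}  f≗g = _
≗⇒≗ᵇ {suc n} f≗g = Equivalence.from T-∧ (≡⇒=ᶠ (f≗g Fin.zero) , ≗⇒≗ᵇ (f≗g ∘ Fin.suc))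

allFuns-multiplicity : ∀ n m (f : Fin n → Fin m) → ∑[ g ∈ allFuns n m ] 𝟙 (f ≗ᵇ g) ≡ 1
allFuns-multiplicity zero    m f = refl
allFuns-multiplicity (suc n) m f =
  trans (∑ˡ-concatMap _ (allFin m) _) (trans (∑ˡ-cong (allFin m) λ x → ∑ˡ-map _ (allFuns n m) _) (begin
    ∑[ x ∈ allFin m ] ∑[ g ∈ allFuns n m ] 𝟙 ((f Fin.zero =ᶠ x) ∧ ((f ∘ Fin.suc) ≗ᵇ g))
      ≡⟨ ∑ˡ-cong (allFin m) (λ x → ∑ˡ-cong (allFuns n m) (λ g → 𝟙-∧ (f Fin.zero =ᶠ x) _)) ⟩
    ∑[ x ∈ allFin m ] ∑[ g ∈ allFuns n m ] (𝟙 (f Fin.zero =ᶠ x) * 𝟙 ((f ∘ Fin.suc) ≗ᵇ g))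
      ≡⟨ ∑ˡ-cong (allFin m) (λ x → sym (*-distribˡ-∑ˡ (𝟙 (f Fin.zero =ᶠ x)) (allFuns n m) _)) ⟩
    ∑[ x ∈ allFin m ] (𝟙 (f Fin.zero =ᶠ x) * ∑[ g ∈ allFuns n m ] 𝟙 ((f ∘ Fin.suc) ≗ᵇ g))
      ≡⟨ ∑ˡ-cong (allFin m) (λ x → cong (𝟙 (f Fin.zero =ᶠ x) *_) (allFuns-multiplicity n m (f ∘ Fin.suc))) ⟩
    ∑[ x ∈ allFin m ] (𝟙 (f Fin.zero =ᶠ x) * 1)
      ≡⟨ ∑ˡ-cong (allFin m) (λ x → *-identityʳ _) ⟩
    ∑[ x ∈ allFin m ] 𝟙 (f Fin.zero =ᶠ x)
      ≡⟨ ∑ˡ-allFin m _ ⟩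
    ∑[ x < m ] 𝟙 (f Fin.zero =ᶠ x)
      ≡⟨ ∑-delta (f Fin.zero) ⟩
    1 ∎))

allFuns-sift : ∀ {w : (Fin n → Fin m) → ℕ} → Congruent _≗_ _≡_ w →
               ∀ f → ∑[ g ∈ allFuns n m ] (𝟙 (f ≗ᵇ g) * w g) ≡ w f
allFuns-sift {n} {m} {w} w-cong f = begin
  ∑[ g ∈ allFuns n m ] (𝟙 (f ≗ᵇ g) * w g) ≡⟨ ∑ˡ-cong (allFuns n m) (λ g → 𝟙*-cong (f ≗ᵇ g) (sym ∘ w-cong ∘ ≗ᵇ⇒≗)) ⟩
  ∑[ g ∈ allFuns n m ] (𝟙 (f ≗ᵇ g) * w f) ≡⟨ *-distribʳ-∑ˡ (w f) (allFuns n m) _ ⟨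
  ∑[ g ∈ allFuns n m ] 𝟙 (f ≗ᵇ g) * w f   ≡⟨ cong (_* w f) (allFuns-multiplicity n m f) ⟩
  1 * w f                                 ≡⟨ *-identityˡ (w f) ⟩
  w f                                     ∎

allFuns-fibres : ∀ (xs : List A) (u : A → ℕ) (F : A → Fin n → Fin m) {w} → Congruent _≗_ _≡_ w →
                 (∀ g → ∑[ a ∈ xs ] (u a * 𝟙 (F a ≗ᵇ g)) * w g ≡ w g) →
                 ∑[ g ∈ allFuns n m ] w g ≡ ∑[ a ∈ xs ] (u a * w (F a))
allFuns-fibres {n = n} {m} xs u F {w} w-cong fibre = begin
  ∑[ g ∈ allFuns n m ] w g
    ≡⟨ ∑ˡ-cong (allFuns n m) (sym ∘ fibre) ⟩
  ∑[ g ∈ allFuns n m ] (∑[ a ∈ xs ] (u a * 𝟙 (F a ≗ᵇ g)) * w g)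
    ≡⟨ ∑ˡ-cong (allFuns n m) (λ g → *-distribʳ-∑ˡ (w g) xs _) ⟩
  ∑[ g ∈ allFuns n m ] ∑[ a ∈ xs ] (u a * 𝟙 (F a ≗ᵇ g) * w g)
    ≡⟨ ∑ˡ-comm (allFuns n m) xs _ ⟩
  ∑[ a ∈ xs ] ∑[ g ∈ allFuns n m ] (u a * 𝟙 (F a ≗ᵇ g) * w g)
    ≡⟨ ∑ˡ-cong xs (λ a → trans (∑ˡ-cong (allFuns n m) (λ g → *-assoc (u a) _ _)) (sym (*-distribˡ-∑ˡ (u a) (allFuns n m) _))) ⟩
  ∑[ a ∈ xs ] (u a * ∑[ g ∈ allFuns n m ] (𝟙 (F a ≗ᵇ g) * w g))
    ≡⟨ ∑ˡ-cong xs (λ a → cong (u a *_) (allFuns-sift w-cong (F a))) ⟩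
  ∑[ a ∈ xs ] (u a * w (F a)) ∎

isPermᵇ⇒injective : ∀ {f : Fin n → Fin n} → T (isPermᵇ f) → Injective _≡_ _≡_ f
isPermᵇ⇒injective {n} {f} perm {i} {j} fi≡fj =
  =ᶠ⇒≡ (T-not-∨⇒→ (f i =ᶠ f j) (tabulate⁻ (all⁺ _ (allFin n) row) j) (≡⇒=ᶠ fi≡fj))
  where row = tabulate⁻ (all⁺ _ (allFin n) perm) i

injective⇒isPermᵇ : ∀ {f : Fin n → Fin n} → Injective _≡_ _≡_ f → T (isPermᵇ f)
injective⇒isPermᵇ {n} {f} f-inj =
  all⁻ _ (tabulate⁺ λ i → all⁻ _ (tabulate⁺ λ j → →⇒T-not-∨ (f i =ᶠ f j) (≡⇒=ᶠ ∘ f-inj ∘ =ᶠ⇒≡)))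

𝟙∘isPermᵇ-cong : Congruent _≗_ _≡_ (𝟙 ∘ isPermᵇ {n})
𝟙∘isPermᵇ-cong f≗g = 𝟙-cong (mk⇔
  (λ f-perm → injective⇒isPermᵇ λ gi≡gj → isPermᵇ⇒injective f-perm (trans (f≗g _) (trans gi≡gj (sym (f≗g _)))))
  (λ g-perm → injective⇒isPermᵇ λ fi≡fj → isPermᵇ⇒injective g-perm (trans (sym (f≗g _)) (trans fi≡fj (f≗g _)))))

injective⇒surjective : ∀ {f : Fin n → Fin n} → Injective _≡_ _≡_ f → ∀ y → ∃ λ x → f x ≡ y
injective⇒surjective {suc n} {f} f-inj y with Fin.any? (λ x → f x Fin.≟ y)
... | yes preimage = preimage
... | no  ∄x = ⊥-elim (1+n≰n (injective⇒≤ {f = f′} (λ {x} {x′} → f-inj ∘ punchOut-injective (avoids x) (avoids x′))))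
  where
  avoids : ∀ x → y ≢ f x
  avoids x y≡fx = ∄x (x , sym y≡fx)
  f′ : Fin (suc n) → Fin n
  f′ x = punchOut (avoids x)

injective⇒∑-preimage : ∀ {f : Fin n → Fin n} → Injective _≡_ _≡_ f → ∀ y → ∑[ x < n ] 𝟙 (f x =ᶠ y) ≡ 1
injective⇒∑-preimage {n} {f} f-inj y with injective⇒surjective f-inj y
... | x₀ , fx₀≡y = begin
  ∑[ x < n ] 𝟙 (f x =ᶠ y) ≡⟨ sum-cong-≗ (λ x → 𝟙-cong (mk⇔ (fx=y⇒x₀=x x) (x₀=x⇒fx=y x))) ⟩
  ∑[ x < n ] 𝟙 (x₀ =ᶠ x)  ≡⟨ ∑-delta x₀ ⟩
  1                       ∎
  where
  fx=y⇒x₀=x : ∀ x → T (f x =ᶠ y) → T (x₀ =ᶠ x)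
  fx=y⇒x₀=x x fx=y = ≡⇒=ᶠ (f-inj (trans fx₀≡y (sym (=ᶠ⇒≡ fx=y))))
  x₀=x⇒fx=y : ∀ x → T (x₀ =ᶠ x) → T (f x =ᶠ y)
  x₀=x⇒fx=y x x₀=x = ≡⇒=ᶠ (trans (cong f (sym (=ᶠ⇒≡ x₀=x))) fx₀≡y)

-- Inserting a new largest element into a permutation

caseTop : A → (Fin n → A) → Fin (suc n) → A
caseTop t f x with view x
... | ‵fromℕ     = t
... | ‵inject₁ i = f i

module _ {t : A} {f : Fin n → A} where

  caseTop-fromℕ : caseTop t f (fromℕ n) ≡ t
  caseTop-fromℕ rewrite view-fromℕ n = refl

  caseTop-inject₁ : ∀ i → caseTop t f (inject₁ i) ≡ f i
  caseTop-inject₁ i rewrite view-inject₁ i = refl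

inject₁-caseTop-id : ∀ (t : Fin n) x → x ≢ fromℕ n → inject₁ (caseTop t id x) ≡ x
inject₁-caseTop-id t x x≢top with view x
... | ‵fromℕ     = ⊥-elim (x≢top refl)
... | ‵inject₁ i = refl

extend : (Fin n → Fin n) → Fin (suc n) → Fin (suc n)
extend σ = caseTop (fromℕ _) (inject₁ ∘ σ)

-- insert σ (inject₁ q) puts the new element fromℕ n on the cycle of σ right after q,
-- i.e. q ↦ fromℕ n ↦ σ q, while insert σ (fromℕ n) makes it a fixed point.
insert : (Fin n → Fin n) → Fin (suc n) → Fin (suc n) → Fin (suc n)
insert {n} σ p = caseTop (extend σ p) (λ i → if p =ᶠ inject₁ i then fromℕ n else inject₁ (σ i))

-- The junk value i is returned only if τ (inject₁ i) and τ (fromℕ n) are both fromℕ n, which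
-- injectivity of τ rules out.
remove : (Fin (suc n) → Fin (suc n)) → Fin n → Fin n
remove {n} τ i = caseTop (caseTop i id (τ (fromℕ n))) id (τ (inject₁ i))

extend-≡-fromℕ : ∀ (σ : Fin n → Fin n) x → extend σ x ≡ fromℕ n → x ≡ fromℕ n
extend-≡-fromℕ σ x σx≡top with view x
... | ‵fromℕ     = refl
... | ‵inject₁ i = ⊥-elim (inject₁≢fromℕ σx≡top)

module _ (σ : Fin n → Fin n) (p : Fin (suc n)) where

  insert-fromℕ : insert σ p (fromℕ n) ≡ extend σ p
  insert-fromℕ = caseTop-fromℕ {n = n}

  insert-self : insert σ p p ≡ fromℕ n
  insert-self with view p
  ... | ‵fromℕ     = refl
  ... | ‵inject₁ q = if-T (≡⇒=ᶠ {i = inject₁ q} refl)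

  insert-inject₁ : ∀ i → p ≢ inject₁ i → insert σ p (inject₁ i) ≡ inject₁ (σ i)
  insert-inject₁ i p≢i = trans (caseTop-inject₁ i) (if-¬T (p≢i ∘ =ᶠ⇒≡))

  insert-inject₁-cases : ∀ i → insert σ p (inject₁ i) ≡ inject₁ (σ i) ⊎ p ≡ inject₁ i
  insert-inject₁-cases i with p Fin.≟ inject₁ i
  ... | yes p≡i = inj₂ p≡i
  ... | no  p≢i = inj₁ (insert-inject₁ i p≢i)

  insert-fromℕ-inject₁ : ∀ q → p ≡ inject₁ q → insert σ p (fromℕ n) ≡ inject₁ (σ q)
  insert-fromℕ-inject₁ q refl = trans insert-fromℕ (caseTop-inject₁ q)

  insert-fromℕ-fixed : p ≡ fromℕ n → insert σ p (fromℕ n) ≡ fromℕ n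
  insert-fromℕ-fixed refl = trans insert-fromℕ (caseTop-fromℕ {n = n})

  insert-≡-fromℕ : ∀ x → insert σ p x ≡ fromℕ n → x ≡ p
  insert-≡-fromℕ x τx≡top with view x
  ... | ‵fromℕ     = sym (extend-≡-fromℕ σ p τx≡top)
  ... | ‵inject₁ i with p Fin.≟ inject₁ i
  ...   | yes p≡i = sym p≡i
  ...   | no  p≢i = ⊥-elim (inject₁≢fromℕ (trans (sym (if-¬T (p≢i ∘ =ᶠ⇒≡))) τx≡top))

  insert-fromℕ≡inject₁ : ∀ {j} → Injective _≡_ _≡_ σ → fromℕ n ≢ p →
                         insert σ p (fromℕ n) ≡ insert σ p (inject₁ j) → inject₁ j ≡ p
  insert-fromℕ≡inject₁ {j} σ-inj top≢p τtop≡τj with fromℕ-or-inject₁ p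
  ... | inj₁ p≡top       = ⊥-elim (top≢p (sym p≡top))
  ... | inj₂ (q , p≡q) with p Fin.≟ inject₁ j
  ...   | yes p≡j = sym p≡j
  ...   | no  p≢j = trans (cong inject₁ (σ-inj (inject₁-injective (begin
    inject₁ (σ j)          ≡⟨ insert-inject₁ j p≢j ⟨
    insert σ p (inject₁ j) ≡⟨ τtop≡τj ⟨
    insert σ p (fromℕ n)   ≡⟨ insert-fromℕ-inject₁ q p≡q ⟩
    inject₁ (σ q)          ∎)))) (sym p≡q)

  insert-injective : Injective _≡_ _≡_ σ → Injective _≡_ _≡_ (insert σ p)
  insert-injective σ-inj {x} {y} τx≡τy with x Fin.≟ p | y Fin.≟ p
  ... | yes refl | _        = sym (insert-≡-fromℕ y (trans (sym τx≡τy) insert-self))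
  ... | no  x≢p  | yes refl = ⊥-elim (x≢p (insert-≡-fromℕ x (trans τx≡τy insert-self)))
  ... | no  x≢p  | no  y≢p  with fromℕ-or-inject₁ x | fromℕ-or-inject₁ y
  ...   | inj₁ refl       | inj₁ refl       = refl
  ...   | inj₁ refl       | inj₂ (j , refl) = ⊥-elim (y≢p (insert-fromℕ≡inject₁ σ-inj x≢p τx≡τy))
  ...   | inj₂ (i , refl) | inj₁ refl       = ⊥-elim (x≢p (insert-fromℕ≡inject₁ σ-inj y≢p (sym τx≡τy)))
  ...   | inj₂ (i , refl) | inj₂ (j , refl) = cong inject₁ (σ-inj (inject₁-injective (begin
    inject₁ (σ i)         ≡⟨ insert-inject₁ i (x≢p ∘ sym) ⟨
    insert σ p (inject₁ i) ≡⟨ τx≡τy ⟩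
    insert σ p (inject₁ j) ≡⟨ insert-inject₁ j (y≢p ∘ sym) ⟩
    inject₁ (σ j)         ∎)))

extend-cong : ∀ {σ σ′ : Fin n → Fin n} → σ ≗ σ′ → extend σ ≗ extend σ′
extend-cong σ≗σ′ x with view x
... | ‵fromℕ     = refl
... | ‵inject₁ i = cong inject₁ (σ≗σ′ i)

insert-cong : ∀ {σ σ′ : Fin n → Fin n} → σ ≗ σ′ → ∀ p → insert σ p ≗ insert σ′ p
insert-cong σ≗σ′ p x with view x
... | ‵fromℕ     = extend-cong σ≗σ′ p
... | ‵inject₁ i = cong (if p =ᶠ inject₁ i then fromℕ _ else_) (cong inject₁ (σ≗σ′ i))

remove-cong : ∀ {τ τ′ : Fin (suc n) → Fin (suc n)} → τ ≗ τ′ → remove τ ≗ remove τ′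
remove-cong {n} τ≗τ′ i = cong₂ (λ a b → caseTop (caseTop i id a) id b) (τ≗τ′ (fromℕ n)) (τ≗τ′ (inject₁ i))

remove-insert : ∀ (σ : Fin n → Fin n) p → remove (insert σ p) ≗ σ
remove-insert {n} σ p i with insert-inject₁-cases σ p i
... | inj₁ τi≡σi = trans (cong (caseTop _ id) τi≡σi) (caseTop-inject₁ (σ i))
... | inj₂ p≡i   = begin
  caseTop (caseTop i id (insert σ p (fromℕ n))) id (insert σ p (inject₁ i))
    ≡⟨ cong (caseTop _ id) (trans (cong (insert σ p) (sym p≡i)) (insert-self σ p)) ⟩
  caseTop (caseTop i id (insert σ p (fromℕ n))) id (fromℕ n)
    ≡⟨ caseTop-fromℕ {n = n} ⟩
  caseTop i id (insert σ p (fromℕ n))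
    ≡⟨ cong (caseTop i id) (insert-fromℕ-inject₁ σ p i p≡i) ⟩
  caseTop i id (inject₁ (σ i))
    ≡⟨ caseTop-inject₁ (σ i) ⟩
  σ i ∎

module _ {τ : Fin (suc n) → Fin (suc n)} (τ-inj : Injective _≡_ _≡_ τ) where

  inject₁-remove : ∀ i → τ (inject₁ i) ≢ fromℕ n → inject₁ (remove τ i) ≡ τ (inject₁ i)
  inject₁-remove i = inject₁-caseTop-id _ (τ (inject₁ i))

  inject₁-remove-fromℕ : ∀ i → τ (inject₁ i) ≡ fromℕ n → inject₁ (remove τ i) ≡ τ (fromℕ n)
  inject₁-remove-fromℕ i τi≡top = begin
    inject₁ (caseTop (caseTop i id (τ (fromℕ n))) id (τ (inject₁ i))) ≡⟨ cong (inject₁ ∘ caseTop _ id) τi≡top ⟩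
    inject₁ (caseTop (caseTop i id (τ (fromℕ n))) id (fromℕ n))       ≡⟨ cong inject₁ (caseTop-fromℕ {n = n}) ⟩
    inject₁ (caseTop i id (τ (fromℕ n)))                              ≡⟨ inject₁-caseTop-id i _ τtop≢top ⟩
    τ (fromℕ n)                                                       ∎
    where
    τtop≢top : τ (fromℕ n) ≢ fromℕ n
    τtop≢top τtop≡top = fromℕ≢inject₁ (τ-inj (trans τtop≡top (sym τi≡top)))

  remove-injective : Injective _≡_ _≡_ (remove τ)
  remove-injective {i} {j} ri≡rj with τ (inject₁ i) Fin.≟ fromℕ n | τ (inject₁ j) Fin.≟ fromℕ n
  ... | yes τi≡top | yes τj≡top = inject₁-injective (τ-inj (trans τi≡top (sym τj≡top)))
  ... | no  τi≢top | no  τj≢top = inject₁-injective (τ-inj (begin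
    τ (inject₁ i)        ≡⟨ inject₁-remove i τi≢top ⟨
    inject₁ (remove τ i) ≡⟨ cong inject₁ ri≡rj ⟩
    inject₁ (remove τ j) ≡⟨ inject₁-remove j τj≢top ⟩
    τ (inject₁ j)        ∎))
  ... | yes τi≡top | no  τj≢top = ⊥-elim (fromℕ≢inject₁ (τ-inj (begin
    τ (fromℕ n)          ≡⟨ inject₁-remove-fromℕ i τi≡top ⟨
    inject₁ (remove τ i) ≡⟨ cong inject₁ ri≡rj ⟩
    inject₁ (remove τ j) ≡⟨ inject₁-remove j τj≢top ⟩
    τ (inject₁ j)        ∎)))
  ... | no  τi≢top | yes τj≡top = ⊥-elim (fromℕ≢inject₁ (τ-inj (begin
    τ (fromℕ n)          ≡⟨ inject₁-remove-fromℕ j τj≡top ⟨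
    inject₁ (remove τ j) ≡⟨ cong inject₁ ri≡rj ⟨
    inject₁ (remove τ i) ≡⟨ inject₁-remove i τi≢top ⟩
    τ (inject₁ i)        ∎)))

  insert-remove : ∀ p → τ p ≡ fromℕ n → insert (remove τ) p ≗ τ
  insert-remove p τp≡top x with fromℕ-or-inject₁ x
  ... | inj₁ refl with fromℕ-or-inject₁ p
  ...   | inj₁ refl       = trans (insert-fromℕ (remove τ) (fromℕ n)) (trans (caseTop-fromℕ {n = n}) (sym τp≡top))
  ...   | inj₂ (q , refl) = trans (insert-fromℕ-inject₁ (remove τ) p q refl) (inject₁-remove-fromℕ q τp≡top)
  insert-remove p τp≡top x | inj₂ (i , refl) with p Fin.≟ inject₁ i
  ... | yes p≡i = trans (cong (insert (remove τ) p) (sym p≡i)) (trans (insert-self (remove τ) p) (sym (trans (cong τ (sym p≡i)) τp≡top)))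
  ... | no  p≢i = trans (insert-inject₁ _ p i p≢i) (inject₁-remove i (λ τi≡top → p≢i (τ-inj (trans τp≡top (sym τi≡top)))))

insert-≗ᵇ : ∀ {τ : Fin (suc n) → Fin (suc n)} → Injective _≡_ _≡_ τ → ∀ σ p →
            𝟙 (insert σ p ≗ᵇ τ) ≡ 𝟙 (remove τ ≗ᵇ σ) * 𝟙 (τ p =ᶠ fromℕ n)
insert-≗ᵇ {n} {τ} τ-inj σ p = trans (𝟙-cong (mk⇔ to from)) (𝟙-∧ (remove τ ≗ᵇ σ) _)
  where
  to : T (insert σ p ≗ᵇ τ) → T ((remove τ ≗ᵇ σ) ∧ (τ p =ᶠ fromℕ n))
  to insert≗τ = Equivalence.from (T-∧ {remove τ ≗ᵇ σ})
    ( ≗⇒≗ᵇ (λ i → trans (remove-cong (sym ∘ insert≗τ′) i) (remove-insert σ p i))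
    , ≡⇒=ᶠ (trans (sym (insert≗τ′ p)) (insert-self σ p)))
    where insert≗τ′ = ≗ᵇ⇒≗ {f = insert σ p} {g = τ} insert≗τ
  from : T ((remove τ ≗ᵇ σ) ∧ (τ p =ᶠ fromℕ n)) → T (insert σ p ≗ᵇ τ)
  from removeτ≗σ∧τp=top with Equivalence.to (T-∧ {remove τ ≗ᵇ σ}) removeτ≗σ∧τp=top
  ... | removeτ≗σ , τp=top = ≗⇒≗ᵇ λ x →
    trans (insert-cong (sym ∘ ≗ᵇ⇒≗ {f = remove τ} {g = σ} removeτ≗σ) p x) (insert-remove τ-inj p (=ᶠ⇒≡ τp=top) x)

insert-fibre : ∀ {τ : Fin (suc n) → Fin (suc n)} → Injective _≡_ _≡_ τ →
               ∑[ σ ∈ allFuns n n ] ∑[ p ∈ allFin (suc n) ] (𝟙 (isPermᵇ σ) * 𝟙 (insert σ p ≗ᵇ τ)) ≡ 1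
insert-fibre {n} {τ} τ-inj = begin
  ∑[ σ ∈ allFuns n n ] ∑[ p ∈ allFin (suc n) ] (𝟙 (isPermᵇ σ) * 𝟙 (insert σ p ≗ᵇ τ))
    ≡⟨ ∑ˡ-cong (allFuns n n) (λ σ → ∑ˡ-cong (allFin (suc n)) λ p → cong (𝟙 (isPermᵇ σ) *_) (insert-≗ᵇ τ-inj σ p)) ⟩
  ∑[ σ ∈ allFuns n n ] ∑[ p ∈ allFin (suc n) ] (𝟙 (isPermᵇ σ) * (𝟙 (remove τ ≗ᵇ σ) * 𝟙 (τ p =ᶠ fromℕ n)))
    ≡⟨ ∑ˡ-cong (allFuns n n) (λ σ → ∑ˡ-cong (allFin (suc n)) λ p →
         x*[y*z]≡y*x*z (𝟙 (isPermᵇ σ)) (𝟙 (remove τ ≗ᵇ σ)) (𝟙 (τ p =ᶠ fromℕ n))) ⟩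
  ∑[ σ ∈ allFuns n n ] ∑[ p ∈ allFin (suc n) ] (𝟙 (remove τ ≗ᵇ σ) * 𝟙 (isPermᵇ σ) * 𝟙 (τ p =ᶠ fromℕ n))
    ≡⟨ ∑ˡ-cong (allFuns n n) (λ σ → sym (*-distribˡ-∑ˡ (𝟙 (remove τ ≗ᵇ σ) * 𝟙 (isPermᵇ σ)) (allFin (suc n)) _)) ⟩
  ∑[ σ ∈ allFuns n n ] (𝟙 (remove τ ≗ᵇ σ) * 𝟙 (isPermᵇ σ) * ∑[ p ∈ allFin (suc n) ] 𝟙 (τ p =ᶠ fromℕ n))
    ≡⟨ ∑ˡ-cong (allFuns n n) (λ σ → cong (𝟙 (remove τ ≗ᵇ σ) * 𝟙 (isPermᵇ σ) *_) preimage) ⟩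
  ∑[ σ ∈ allFuns n n ] (𝟙 (remove τ ≗ᵇ σ) * 𝟙 (isPermᵇ σ) * 1)
    ≡⟨ ∑ˡ-cong (allFuns n n) (λ σ → *-identityʳ _) ⟩
  ∑[ σ ∈ allFuns n n ] (𝟙 (remove τ ≗ᵇ σ) * 𝟙 (isPermᵇ σ))
    ≡⟨ allFuns-sift 𝟙∘isPermᵇ-cong (remove τ) ⟩
  𝟙 (isPermᵇ (remove τ))
    ≡⟨ 𝟙-T (injective⇒isPermᵇ (remove-injective τ-inj)) ⟩
  1 ∎
  where
  preimage : ∑[ p ∈ allFin (suc n) ] 𝟙 (τ p =ᶠ fromℕ n) ≡ 1
  preimage = trans (∑ˡ-allFin (suc n) _) (injective⇒∑-preimage τ-inj (fromℕ n))

-- Cycles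

iter-+ : ∀ (f : Fin n → Fin n) a b i → iter f (a + b) i ≡ iter f a (iter f b i)
iter-+ f zero    b i = refl
iter-+ f (suc a) b i = cong f (iter-+ f a b i)

iter-cong : ∀ {f g : Fin n → Fin n} → f ≗ g → ∀ j → iter f j ≗ iter g j
iter-cong f≗g zero    i = refl
iter-cong {f = f} f≗g (suc j) i = trans (cong f (iter-cong f≗g j i)) (f≗g _)

iter-repeats : ∀ (f : Fin n → Fin n) i → ∃ λ a → ∃ λ b → a < b × b ≤ n × iter f a i ≡ iter f b i
iter-repeats {n} f i with Fin.pigeonhole (n<1+n n) (λ (k : Fin (suc n)) → iter f (toℕ k) i)
... | a , b , a<b , fᵃi≡fᵇi = toℕ a , toℕ b , a<b , s≤s⁻¹ (toℕ<n b) , fᵃi≡fᵇi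

iter-shift : ∀ (f : Fin n → Fin n) i {a b} → iter f a i ≡ iter f b i → ∀ d → iter f (d + b) i ≡ iter f (d + a) i
iter-shift f i {a} {b} fᵃi≡fᵇi d = begin
  iter f (d + b) i            ≡⟨ iter-+ f d b i ⟩
  iter f d (iter f b i)       ≡⟨ cong (iter f d) fᵃi≡fᵇi ⟨
  iter f d (iter f a i)       ≡⟨ iter-+ f d a i ⟨
  iter f (d + a) i            ∎

iter-below : ∀ (f : Fin n → Fin n) i j → ∃ λ j′ → j′ < n × iter f j i ≡ iter f j′ i
iter-below {n} f i = <-rec _ step
  where
  step : ∀ j → (∀ {j₂} → j₂ < j → ∃ λ j′ → j′ < n × iter f j₂ i ≡ iter f j′ i) →
         ∃ λ j′ → j′ < n × iter f j i ≡ iter f j′ i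
  step j rec with j <? n | iter-repeats f i
  ... | yes j<n | _ = j , j<n , refl
  ... | no  j≮n | a , b , a<b , b≤n , fᵃi≡fᵇi =
    let j′ , j′<n , fʲ²i≡fʲ′i = rec j₂<j in j′ , j′<n , trans fʲi≡fʲ²i fʲ²i≡fʲ′i
    where
    b≤j : b ≤ j
    b≤j = ≤-trans b≤n (≮⇒≥ j≮n)
    j₂<j : j ∸ b + a < j
    j₂<j = subst (j ∸ b + a <_) (m∸n+n≡m b≤j) (+-monoʳ-< (j ∸ b) a<b)
    fʲi≡fʲ²i : iter f j i ≡ iter f (j ∸ b + a) i
    fʲi≡fʲ²i = trans (cong (λ d → iter f d i) (sym (m∸n+n≡m b≤j))) (iter-shift f i fᵃi≡fᵇi (j ∸ b))

T-isCycleMinᵇ : ∀ (f : Fin n → Fin n) i → T (isCycleMinᵇ f i) ⇔ (∀ j → toℕ i ≤ toℕ (iter f j i))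
T-isCycleMinᵇ {n} f i = mk⇔ to from
  where
  to : T (isCycleMinᵇ f i) → ∀ j → toℕ i ≤ toℕ (iter f j i)
  to minᵇ j with iter-below f i j
  ... | j′ , j′<n , fʲi≡fʲ′i = subst (λ x → toℕ i ≤ toℕ x) (sym fʲi≡fʲ′i)
    (≤ᵇ⇒≤ (toℕ i) _ (applyUpTo⁻ id n (all⁺ _ (upTo n) minᵇ) j′<n))
  from : (∀ j → toℕ i ≤ toℕ (iter f j i)) → T (isCycleMinᵇ f i)
  from min = all⁻ _ (applyUpTo⁺₁ id n λ {j} _ → ≤⇒≤ᵇ (min j))

numCycles-∑ : ∀ (f : Fin n → Fin n) → numCycles f ≡ ∑[ i < n ] 𝟙 (isCycleMinᵇ f i)
numCycles-∑ {n} f = trans (length-filterᵇ (isCycleMinᵇ f) (allFin n)) (∑ˡ-allFin n _)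

isCycleMinᵇ-transport : ∀ {f g : Fin n → Fin n} → f ≗ g → ∀ i → T (isCycleMinᵇ f i) → T (isCycleMinᵇ g i)
isCycleMinᵇ-transport {f = f} {g} f≗g i minᶠ = Equivalence.from (T-isCycleMinᵇ g i) λ j →
  subst (λ x → toℕ i ≤ toℕ x) (iter-cong f≗g j i) (Equivalence.to (T-isCycleMinᵇ f i) minᶠ j)

numCycles-cong : Congruent _≗_ _≡_ (numCycles {n})
numCycles-cong {x = f} {g} f≗g = begin
  numCycles f                       ≡⟨ numCycles-∑ f ⟩
  ∑[ i < _ ] 𝟙 (isCycleMinᵇ f i)    ≡⟨ sum-cong-≗ (λ i → 𝟙-cong (mk⇔ (isCycleMinᵇ-transport f≗g i)
                                                                    (isCycleMinᵇ-transport (sym ∘ f≗g) i))) ⟩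
  ∑[ i < _ ] 𝟙 (isCycleMinᵇ g i)    ≡⟨ numCycles-∑ g ⟨
  numCycles g                       ∎

module _ (σ : Fin n → Fin n) (p : Fin (suc n)) where

  private
    τ = insert σ p

  iter-insert-reaches : ∀ i j → ∃ λ j′ → iter τ j′ (inject₁ i) ≡ inject₁ (iter σ j i)
  iter-insert-reaches i zero = 0 , refl
  iter-insert-reaches i (suc j) with iter-insert-reaches i j
  ... | j′ , τʲ′i≡σʲi with insert-inject₁-cases σ p (iter σ j i)
  ...   | inj₁ τσʲi≡σʲ⁺¹i = suc j′ , trans (cong τ τʲ′i≡σʲi) τσʲi≡σʲ⁺¹i
  ...   | inj₂ p≡σʲi      = suc (suc j′) , (begin
    τ (τ (iter τ j′ (inject₁ i))) ≡⟨ cong (τ ∘ τ) (trans τʲ′i≡σʲi (sym p≡σʲi)) ⟩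
    τ (τ p)                       ≡⟨ cong τ (insert-self σ p) ⟩
    τ (fromℕ n)                   ≡⟨ insert-fromℕ-inject₁ σ p _ p≡σʲi ⟩
    inject₁ (σ (iter σ j i))      ∎)

  -- The τ-orbit of inject₁ i leaves the σ-orbit of i only to visit fromℕ n,
  -- which happens only right after p, so that p lies on the σ-orbit.
  iter-insert-stays : ∀ i j →
      (∃ λ j′ → iter τ j (inject₁ i) ≡ inject₁ (iter σ j′ i))
    ⊎ (iter τ j (inject₁ i) ≡ fromℕ n × (p ≡ fromℕ n ⊎ ∃ λ j′ → p ≡ inject₁ (iter σ j′ i)))
  iter-insert-stays i zero = inj₁ (0 , refl)
  iter-insert-stays i (suc j) with iter-insert-stays i j
  ... | inj₁ (j′ , τʲi≡σʲ′i) with insert-inject₁-cases σ p (iter σ j′ i)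
  ...   | inj₁ τσʲ′i≡σʲ′⁺¹i = inj₁ (suc j′ , trans (cong τ τʲi≡σʲ′i) τσʲ′i≡σʲ′⁺¹i)
  ...   | inj₂ p≡σʲ′i       =
    inj₂ (trans (cong τ (trans τʲi≡σʲ′i (sym p≡σʲ′i))) (insert-self σ p) , inj₂ (j′ , p≡σʲ′i))
  iter-insert-stays i (suc j) | inj₂ (τʲi≡top , inj₁ p≡top) =
    inj₂ (trans (cong τ τʲi≡top) (insert-fromℕ-fixed σ p p≡top) , inj₁ p≡top)
  iter-insert-stays i (suc j) | inj₂ (τʲi≡top , inj₂ (j′ , p≡σʲ′i)) =
    inj₁ (suc j′ , trans (cong τ τʲi≡top) (insert-fromℕ-inject₁ σ p _ p≡σʲ′i))

  isCycleMinᵇ-insert-inject₁ : ∀ i → 𝟙 (isCycleMinᵇ τ (inject₁ i)) ≡ 𝟙 (isCycleMinᵇ σ i)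
  isCycleMinᵇ-insert-inject₁ i = 𝟙-cong (mk⇔
    (Equivalence.from (T-isCycleMinᵇ σ i) ∘ τ-min⇒σ-min ∘ Equivalence.to (T-isCycleMinᵇ τ (inject₁ i)))
    (Equivalence.from (T-isCycleMinᵇ τ (inject₁ i)) ∘ σ-min⇒τ-min ∘ Equivalence.to (T-isCycleMinᵇ σ i)))
    where
    toℕi = toℕ-inject₁ i
    τ-min⇒σ-min : (∀ j → toℕ (inject₁ i) ≤ toℕ (iter τ j (inject₁ i))) → ∀ j → toℕ i ≤ toℕ (iter σ j i)
    τ-min⇒σ-min min j with iter-insert-reaches i j
    ... | j′ , τʲ′i≡σʲi = subst₂ _≤_ toℕi (trans (cong toℕ τʲ′i≡σʲi) (toℕ-inject₁ _)) (min j′)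
    σ-min⇒τ-min : (∀ j → toℕ i ≤ toℕ (iter σ j i)) → ∀ j → toℕ (inject₁ i) ≤ toℕ (iter τ j (inject₁ i))
    σ-min⇒τ-min min j with iter-insert-stays i j
    ... | inj₁ (j′ , τʲi≡σʲ′i) = subst₂ _≤_ (sym toℕi) (sym (trans (cong toℕ τʲi≡σʲ′i) (toℕ-inject₁ _))) (min j′)
    ... | inj₂ (τʲi≡top , _)   = subst₂ _≤_ (sym toℕi) (sym (trans (cong toℕ τʲi≡top) (toℕ-fromℕ n))) (<⇒≤ (toℕ<n i))

  isCycleMinᵇ-insert-fromℕ : 𝟙 (isCycleMinᵇ τ (fromℕ n)) ≡ 𝟙 (p =ᶠ fromℕ n)
  isCycleMinᵇ-insert-fromℕ = 𝟙-cong (mk⇔ min⇒p=top p=top⇒min)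
    where
    min⇒p=top : T (isCycleMinᵇ τ (fromℕ n)) → T (p =ᶠ fromℕ n)
    min⇒p=top min with fromℕ-or-inject₁ p
    ... | inj₁ p≡top       = ≡⇒=ᶠ p≡top
    ... | inj₂ (q , p≡q) = ⊥-elim (<⇒≱ τtop<top (Equivalence.to (T-isCycleMinᵇ τ (fromℕ n)) min 1))
      where
      τtop<top : toℕ (τ (fromℕ n)) < toℕ (fromℕ n)
      τtop<top = subst₂ _<_ (sym (trans (cong toℕ (insert-fromℕ-inject₁ σ p q p≡q)) (toℕ-inject₁ _)))
                            (sym (toℕ-fromℕ n)) (toℕ<n (σ q))
    p=top⇒min : T (p =ᶠ fromℕ n) → T (isCycleMinᵇ τ (fromℕ n))
    p=top⇒min p=top = Equivalence.from (T-isCycleMinᵇ τ (fromℕ n)) λ j → ≤-reflexive (cong toℕ (sym (fixed j)))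
      where
      fixed : ∀ j → iter τ j (fromℕ n) ≡ fromℕ n
      fixed zero    = refl
      fixed (suc j) = trans (cong τ (fixed j)) (insert-fromℕ-fixed σ p (=ᶠ⇒≡ p=top))

  numCycles-insert : numCycles τ ≡ 𝟙 (p =ᶠ fromℕ n) + numCycles σ
  numCycles-insert = begin
    numCycles τ                                                             ≡⟨ numCycles-∑ τ ⟩
    ∑[ x < suc n ] 𝟙 (isCycleMinᵇ τ x)                                      ≡⟨ sum-init-last (𝟙 ∘ isCycleMinᵇ τ) ⟩
    ∑[ i < n ] 𝟙 (isCycleMinᵇ τ (inject₁ i)) + 𝟙 (isCycleMinᵇ τ (fromℕ n))
      ≡⟨ cong₂ _+_ (sum-cong-≗ isCycleMinᵇ-insert-inject₁) isCycleMinᵇ-insert-fromℕ ⟩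
    ∑[ i < n ] 𝟙 (isCycleMinᵇ σ i) + 𝟙 (p =ᶠ fromℕ n)                       ≡⟨ cong (_+ _) (numCycles-∑ σ) ⟨
    numCycles σ + 𝟙 (p =ᶠ fromℕ n)                                          ≡⟨ +-comm (numCycles σ) _ ⟩
    𝟙 (p =ᶠ fromℕ n) + numCycles σ                                          ∎

-- The recurrence for Stirling numbers of the first kind

c⁻ : ℕ → ℕ → ℕ
c⁻ n zero    = 0
c⁻ n (suc k) = c n k

permWithCycles : ℕ → (Fin n → Fin n) → ℕ
permWithCycles k τ = 𝟙 (isPermᵇ τ) * 𝟙 (numCycles τ ≡ᵇ k)

permWithCycles-cong : ∀ k → Congruent _≗_ _≡_ (permWithCycles {n} k)
permWithCycles-cong k f≗g = cong₂ _*_ (𝟙∘isPermᵇ-cong f≗g) (cong (λ m → 𝟙 (m ≡ᵇ k)) (numCycles-cong f≗g))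

c-∑ : ∀ n k → c n k ≡ ∑[ σ ∈ allFuns n n ] permWithCycles k σ
c-∑ n k = trans (length-filterᵇ _ (perms n)) (∑ˡ-filterᵇ isPermᵇ (allFuns n n) _)

c⁻-∑ : ∀ n k → c⁻ n k ≡ ∑[ σ ∈ allFuns n n ] (𝟙 (isPermᵇ σ) * 𝟙 (suc (numCycles σ) ≡ᵇ k))
c⁻-∑ n zero    = sym (trans (∑ˡ-cong (allFuns n n) (λ σ → *-zeroʳ (𝟙 (isPermᵇ σ)))) (∑ˡ-zero (allFuns n n)))
c⁻-∑ n (suc k) = c-∑ n k

c-suc-via-insert : ∀ n k → c (suc n) k ≡
  ∑[ σ ∈ allFuns n n ] (𝟙 (isPermᵇ σ) * ∑[ p ∈ allFin (suc n) ] permWithCycles k (insert σ p))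
c-suc-via-insert n k = begin
  c (suc n) k
    ≡⟨ c-∑ (suc n) k ⟩
  ∑[ τ ∈ allFuns (suc n) (suc n) ] permWithCycles k τ
    ≡⟨ allFuns-fibres pairs (λ a → 𝟙 (isPermᵇ (proj₁ a))) (λ a → insert (proj₁ a) (proj₂ a))
                      (permWithCycles-cong k) fibre ⟩
  ∑[ a ∈ pairs ] (𝟙 (isPermᵇ (proj₁ a)) * permWithCycles k (insert (proj₁ a) (proj₂ a)))
    ≡⟨ ∑ˡ-cartesianProduct (allFuns n n) (allFin (suc n)) _ ⟩
  ∑[ σ ∈ allFuns n n ] ∑[ p ∈ allFin (suc n) ] (𝟙 (isPermᵇ σ) * permWithCycles k (insert σ p))
    ≡⟨ ∑ˡ-cong (allFuns n n) (λ σ → *-distribˡ-∑ˡ (𝟙 (isPermᵇ σ)) (allFin (suc n)) _) ⟨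
  ∑[ σ ∈ allFuns n n ] (𝟙 (isPermᵇ σ) * ∑[ p ∈ allFin (suc n) ] permWithCycles k (insert σ p)) ∎
  where
  pairs = cartesianProduct (allFuns n n) (allFin (suc n))
  fibre : ∀ τ → ∑[ a ∈ pairs ] (𝟙 (isPermᵇ (proj₁ a)) * 𝟙 (insert (proj₁ a) (proj₂ a) ≗ᵇ τ)) * permWithCycles k τ
              ≡ permWithCycles k τ
  fibre τ = 𝟙-guarded-*-identityˡ (isPermᵇ τ) _ λ τ-perm →
    trans (∑ˡ-cartesianProduct (allFuns n n) (allFin (suc n)) _) (insert-fibre (isPermᵇ⇒injective {f = τ} τ-perm))

∑-permWithCycles-insert : ∀ k {σ : Fin n → Fin n} → T (isPermᵇ σ) →
  ∑[ p ∈ allFin (suc n) ] permWithCycles k (insert σ p) ≡ n * 𝟙 (numCycles σ ≡ᵇ k) + 𝟙 (suc (numCycles σ) ≡ᵇ k)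
∑-permWithCycles-insert {n} k {σ} σ-perm =
  trans (∑ˡ-cong (allFin (suc n)) inserted) (∑-split-fromℕ n (λ x → 𝟙 (x + numCycles σ ≡ᵇ k)))
  where
  inserted : ∀ p → permWithCycles k (insert σ p) ≡ 𝟙 (𝟙 (p =ᶠ fromℕ n) + numCycles σ ≡ᵇ k)
  inserted p = begin
    𝟙 (isPermᵇ (insert σ p)) * 𝟙 (numCycles (insert σ p) ≡ᵇ k)
      ≡⟨ cong₂ (λ a m → a * 𝟙 (m ≡ᵇ k)) (𝟙-T (injective⇒isPermᵇ (insert-injective σ p (isPermᵇ⇒injective σ-perm))))
                                         (numCycles-insert σ p) ⟩
    1 * 𝟙 (𝟙 (p =ᶠ fromℕ n) + numCycles σ ≡ᵇ k)
      ≡⟨ *-identityˡ _ ⟩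
    𝟙 (𝟙 (p =ᶠ fromℕ n) + numCycles σ ≡ᵇ k) ∎

c-suc : ∀ n k → c (suc n) k ≡ n * c n k + c⁻ n k
c-suc n k = begin
  c (suc n) k
    ≡⟨ c-suc-via-insert n k ⟩
  ∑[ σ ∈ allFuns n n ] (𝟙 (isPermᵇ σ) * ∑[ p ∈ allFin (suc n) ] permWithCycles k (insert σ p))
    ≡⟨ ∑ˡ-cong (allFuns n n) (λ σ → 𝟙*-cong (isPermᵇ σ) (∑-permWithCycles-insert k {σ})) ⟩
  ∑[ σ ∈ allFuns n n ] (𝟙 (isPermᵇ σ) * (n * 𝟙 (numCycles σ ≡ᵇ k) + 𝟙 (suc (numCycles σ) ≡ᵇ k)))
    ≡⟨ ∑ˡ-cong (allFuns n n) (λ σ → distribute (𝟙 (isPermᵇ σ)) (𝟙 (numCycles σ ≡ᵇ k)) (𝟙 (suc (numCycles σ) ≡ᵇ k))) ⟩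
  ∑[ σ ∈ allFuns n n ] (n * permWithCycles k σ + 𝟙 (isPermᵇ σ) * 𝟙 (suc (numCycles σ) ≡ᵇ k))
    ≡⟨ ∑ˡ-distrib-+ (allFuns n n) _ _ ⟩
  ∑[ σ ∈ allFuns n n ] (n * permWithCycles k σ) + ∑[ σ ∈ allFuns n n ] (𝟙 (isPermᵇ σ) * 𝟙 (suc (numCycles σ) ≡ᵇ k))
    ≡⟨ cong₂ _+_ (trans (sym (*-distribˡ-∑ˡ n (allFuns n n) _)) (cong (n *_) (sym (c-∑ n k)))) (sym (c⁻-∑ n k)) ⟩
  n * c n k + c⁻ n k ∎
  where
  distribute : ∀ x y z → x * (n * y + z) ≡ n * (x * y) + x * z
  distribute x y z = trans (*-distribˡ-+ x (n * y) z) (cong (_+ x * z) (x*[y*z]≡y*[x*z] x n y))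

c-suc-zero : ∀ n → c (suc n) 0 ≡ 0
c-suc-zero zero    = c-suc 0 0
c-suc-zero (suc n) = begin
  c (2 + n) 0                 ≡⟨ c-suc (suc n) 0 ⟩
  suc n * c (suc n) 0 + 0     ≡⟨ cong (λ x → suc n * x + 0) (c-suc-zero n) ⟩
  suc n * 0 + 0               ≡⟨ trans (+-identityʳ (suc n * 0)) (*-zeroʳ (suc n)) ⟩
  0                           ∎

c-vanishes : ∀ {n k} → n < k → c n k ≡ 0
c-vanishes {zero}  {suc k} _         = refl
c-vanishes {suc n} {suc k} (s<s n<k) = begin
  c (suc n) (suc k)           ≡⟨ c-suc n (suc k) ⟩
  n * c n (suc k) + c n k     ≡⟨ cong₂ (λ x y → n * x + y) (c-vanishes (m<n⇒m<1+n n<k)) (c-vanishes n<k) ⟩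
  n * 0 + 0                   ≡⟨ trans (+-identityʳ (n * 0)) (*-zeroʳ n) ⟩
  0                           ∎

c-suc-one : ∀ n → c (suc n) 1 ≡ n !
c-suc-one zero    = refl
c-suc-one (suc n) = begin
  c (2 + n) 1                         ≡⟨ c-suc (suc n) 1 ⟩
  suc n * c (suc n) 1 + c (suc n) 0   ≡⟨ cong₂ (λ x y → suc n * x + y) (c-suc-one n) (c-suc-zero n) ⟩
  suc n * n ! + 0                     ≡⟨ +-identityʳ _ ⟩
  suc n !                             ∎

-- The coefficient C(n-1,k-1) (n-k-1)! of the theorem, with m = n - 1 and t = k - 1.
coeff : ℕ → ℕ → ℕ
coeff m t = (m C t) * (m ∸ t ∸ 1) !

coeff-pascal : ∀ m t → coeff m t + (m C suc t) * (m ∸ suc t) ! ≡ coeff (suc m) (suc t)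
coeff-pascal m t = begin
  (m C t) * (m ∸ t ∸ 1) ! + (m C suc t) * (m ∸ suc t) !
    ≡⟨ cong (λ d → (m C t) * (m ∸ t ∸ 1) ! + (m C suc t) * d !) (pred[m∸n]≡m∸[1+n] m t) ⟨
  (m C t) * (m ∸ t ∸ 1) ! + (m C suc t) * (m ∸ t ∸ 1) !
    ≡⟨ *-distribʳ-+ ((m ∸ t ∸ 1) !) (m C t) (m C suc t) ⟨
  (m C t + m C suc t) * (m ∸ t ∸ 1) !
    ≡⟨ cong (_* (m ∸ t ∸ 1) !) (nCk+nC[k+1]≡[n+1]C[k+1] m t) ⟩
  (suc m C suc t) * (m ∸ t ∸ 1) ! ∎

∑-coeff-suc : ∀ m (f : ℕ → ℕ) →
  ∑[ t < m ] (coeff m (toℕ t) * f (suc (toℕ t))) + ∑[ t < suc m ] ((m C toℕ t) * (m ∸ toℕ t) ! * f (toℕ t))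
    ≡ ∑[ t < suc m ] (coeff (suc m) (toℕ t) * f (toℕ t))
∑-coeff-suc m f = begin
  sum g + (1 * m ! * f 0 + sum h)     ≡⟨ x+[y+z]≡y+[x+z] (sum g) (1 * m ! * f 0) (sum h) ⟩
  1 * m ! * f 0 + (sum g + sum h)     ≡⟨ cong (1 * m ! * f 0 +_) (∑-distrib-+ g h) ⟨
  1 * m ! * f 0 + ∑[ t < m ] (g t + h t)
    ≡⟨ cong (1 * m ! * f 0 +_) (sum-cong-≗ pascal) ⟩
  1 * m ! * f 0 + ∑[ t < m ] (coeff (suc m) (suc (toℕ t)) * f (suc (toℕ t))) ∎
  where
  g h : Fin m → ℕ
  g t = coeff m (toℕ t) * f (suc (toℕ t))
  h t = (m C suc (toℕ t)) * (m ∸ suc (toℕ t)) ! * f (suc (toℕ t))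
  pascal : ∀ t → g t + h t ≡ coeff (suc m) (suc (toℕ t)) * f (suc (toℕ t))
  pascal t = trans (sym (*-distribʳ-+ (f (suc (toℕ t))) (coeff m (toℕ t)) _))
                   (cong (_* f (suc (toℕ t))) (coeff-pascal m (toℕ t)))

coeff-step : ∀ m t k → t < m →
  suc m * (coeff m t * c (suc t) k) + coeff m t * c⁻ (suc t) k
    ≡ coeff m t * c (2 + t) k + (m C t) * (m ∸ t) ! * c (suc t) k
coeff-step m t k t<m = begin
  suc m * (b * f * x) + b * f * x′             ≡⟨ cong (λ s → s * (b * f * x) + b * f * x′) 1+m≡1+t+d ⟩
  (suc t + d) * (b * f * x) + b * f * x′       ≡⟨ regroup b f x x′ t d ⟩
  b * f * (suc t * x + x′) + b * (d * f) * x   ≡⟨ cong₂ (λ u v → b * f * u + b * v * x) (sym (c-suc (suc t) k)) (sym d!≡d*f) ⟩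
  b * f * c (2 + t) k + b * d ! * x            ∎
  where
  b = m C t
  d = m ∸ t
  f = (d ∸ 1) !
  x = c (suc t) k
  x′ = c⁻ (suc t) k
  1+m≡1+t+d : suc m ≡ suc t + d
  1+m≡1+t+d = cong suc (sym (m+[n∸m]≡n (<⇒≤ t<m)))
  d!≡d*f : d ! ≡ d * f
  d!≡d*f = trans (cong _! (sym 1+[d-1]≡d)) (cong (_* f) 1+[d-1]≡d)
    where 1+[d-1]≡d = suc-pred d {{>-nonZero (m<n⇒0<n∸m t<m)}}
  regroup : ∀ b f x x′ t d → (suc t + d) * (b * f * x) + b * f * x′ ≡ b * f * (suc t * x + x′) + b * (d * f) * x
  regroup = solve-∀

∑coeff*c-suc : ∀ m k →
  suc m * ∑[ t < m ] (coeff m (toℕ t) * c (suc (toℕ t)) k)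
    + ∑[ t < m ] (coeff m (toℕ t) * c⁻ (suc (toℕ t)) k) + c (suc m) k
  ≡ ∑[ t < suc m ] (coeff (suc m) (toℕ t) * c (suc (toℕ t)) k)
∑coeff*c-suc m k = begin
  suc m * sum coeff*c + sum coeff*c⁻ + c (suc m) k
    ≡⟨ cong (λ s → s + sum coeff*c⁻ + c (suc m) k) (*-distribˡ-sum (suc m) coeff*c) ⟩
  ∑[ t < m ] (suc m * coeff*c t) + sum coeff*c⁻ + c (suc m) k
    ≡⟨ cong (_+ c (suc m) k) (∑-distrib-+ _ coeff*c⁻) ⟨
  ∑[ t < m ] (suc m * coeff*c t + coeff*c⁻ t) + c (suc m) k
    ≡⟨ cong (_+ c (suc m) k) (sum-cong-≗ λ t → coeff-step m (toℕ t) k (toℕ<n t)) ⟩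
  ∑[ t < m ] (coeff*c₂ t + w (toℕ t)) + c (suc m) k
    ≡⟨ cong (_+ c (suc m) k) (∑-distrib-+ coeff*c₂ (w ∘ toℕ)) ⟩
  sum coeff*c₂ + ∑[ t < m ] w (toℕ t) + c (suc m) k
    ≡⟨ +-assoc (sum coeff*c₂) _ _ ⟩
  sum coeff*c₂ + (∑[ t < m ] w (toℕ t) + c (suc m) k)
    ≡⟨ cong (sum coeff*c₂ +_) (trans (∑-toℕ-last m w) (cong (∑[ t < m ] w (toℕ t) +_) w[m]≡c[1+m,k])) ⟨
  sum coeff*c₂ + ∑[ t < suc m ] w (toℕ t)
    ≡⟨ ∑-coeff-suc m (λ t → c (suc t) k) ⟩
  ∑[ t < suc m ] (coeff (suc m) (toℕ t) * c (suc (toℕ t)) k) ∎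
  where
  coeff*c coeff*c⁻ coeff*c₂ : Fin m → ℕ
  coeff*c t = coeff m (toℕ t) * c (suc (toℕ t)) k
  coeff*c⁻ t = coeff m (toℕ t) * c⁻ (suc (toℕ t)) k
  coeff*c₂ t = coeff m (toℕ t) * c (2 + toℕ t) k
  w : ℕ → ℕ
  w t = (m C t) * (m ∸ t) ! * c (suc t) k
  w[m]≡c[1+m,k] : w m ≡ c (suc m) k
  w[m]≡c[1+m,k] = begin
    (m C m) * (m ∸ m) ! * c (suc m) k ≡⟨ cong₂ (λ b d → b * d ! * c (suc m) k) (nCn≡1 m) (n∸n≡0 m) ⟩
    1 * 1 * c (suc m) k               ≡⟨ *-identityˡ (c (suc m) k) ⟩
    c (suc m) k                       ∎

k*c[1+m,1+k]≡∑coeff*c : ∀ m k → k * c (suc m) (suc k) ≡ ∑[ t < m ] (coeff m (toℕ t) * c (suc (toℕ t)) k)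
k*c[1+m,1+k]≡∑coeff*c zero    zero    = refl
k*c[1+m,1+k]≡∑coeff*c zero    (suc k) = *-zeroʳ (suc k)
k*c[1+m,1+k]≡∑coeff*c (suc m) k = begin
  k * c (2 + m) (suc k)
    ≡⟨ cong (k *_) (c-suc (suc m) (suc k)) ⟩
  k * (suc m * c (suc m) (suc k) + c (suc m) k)
    ≡⟨ trans (*-distribˡ-+ k _ _) (cong (_+ k * c (suc m) k) (x*[y*z]≡y*[x*z] k (suc m) _)) ⟩
  suc m * (k * c (suc m) (suc k)) + k * c (suc m) k
    ≡⟨ cong₂ (λ u v → suc m * u + v) (k*c[1+m,1+k]≡∑coeff*c m k) (k*c[1+m,k] k) ⟩
  suc m * sum coeff*c + (c (suc m) k + sum coeff*c⁻)
    ≡⟨ x+[y+z]≡x+z+y (suc m * sum coeff*c) (c (suc m) k) (sum coeff*c⁻) ⟩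
  suc m * sum coeff*c + sum coeff*c⁻ + c (suc m) k
    ≡⟨ ∑coeff*c-suc m k ⟩
  ∑[ t < suc m ] (coeff (suc m) (toℕ t) * c (suc (toℕ t)) k) ∎
  where
  coeff*c coeff*c⁻ : Fin m → ℕ
  coeff*c t = coeff m (toℕ t) * c (suc (toℕ t)) k
  coeff*c⁻ t = coeff m (toℕ t) * c⁻ (suc (toℕ t)) k
  k*c[1+m,k] : ∀ k → k * c (suc m) k ≡ c (suc m) k + ∑[ t < m ] (coeff m (toℕ t) * c⁻ (suc (toℕ t)) k)
  k*c[1+m,k] zero    = sym (trans (cong₂ _+_ (c-suc-zero m) (sum-cong-≗ {m} (λ t → *-zeroʳ (coeff m (toℕ t)))))
                                  (sum-replicate-zero m))
  k*c[1+m,k] (suc k) = cong (c (suc m) (suc k) +_) (k*c[1+m,1+k]≡∑coeff*c m k)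

-- The alternating sums a n

∑ℤ-syntax : ∀ n → (Fin n → ℤ) → ℤ
∑ℤ-syntax _ = ℤΣ.sum

syntax ∑ℤ-syntax n (λ i → x) = ∑ℤ[ i < n ] x

foldr-applyUpTo : ∀ n (g : ℕ → ℤ) → foldr ℤ._+_ (ℤ.+ 0) (applyUpTo g n) ≡ ∑ℤ[ i < n ] g (toℕ i)
foldr-applyUpTo zero    g = refl
foldr-applyUpTo (suc n) g = cong (λ s → g 0 ℤ.+ s) (foldr-applyUpTo n (g ∘ suc))

Σ[1⋯]-as-∑ℤ : ∀ n (f : ℕ → ℤ) → Σ[ 1 ⋯ n ] f ≡ ∑ℤ[ i < n ] f (suc (toℕ i))
Σ[1⋯]-as-∑ℤ n f = trans (cong (foldr ℤ._+_ (ℤ.+ 0)) (map-upTo (λ i → f (suc i)) n)) (foldr-applyUpTo n (λ i → f (suc i)))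

pos-∑ : ∀ n (f : Fin n → ℕ) → ℤ.+ (∑[ i < n ] f i) ≡ ∑ℤ[ i < n ] (ℤ.+ f i)
pos-∑ zero    f = refl
pos-∑ (suc n) f = trans (ℤ.pos-+ (f Fin.zero) _) (cong (λ s → ℤ.+ f Fin.zero ℤ.+ s) (pos-∑ n (f ∘ Fin.suc)))

neg-∑ : ∀ n (f : Fin n → ℤ) → ℤ.- (∑ℤ[ i < n ] f i) ≡ ∑ℤ[ i < n ] (ℤ.- f i)
neg-∑ zero    f = refl
neg-∑ (suc n) f = trans (ℤ.neg-distrib-+ (f Fin.zero) _) (cong (λ s → ℤ.- f Fin.zero ℤ.+ s) (neg-∑ n (f ∘ Fin.suc)))

∑ℤ-extend : ∀ n d (f : ℕ → ℤ) → (∀ i → n ≤ i → f i ≡ ℤ.+ 0) → ∑ℤ[ i < n + d ] f (toℕ i) ≡ ∑ℤ[ i < n ] f (toℕ i)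
∑ℤ-extend zero    d f f≡0 = trans (ℤΣ.sum-cong-≗ {d} (λ i → f≡0 (toℕ i) z≤n)) (ℤΣ.sum-replicate-zero d)
∑ℤ-extend (suc n) d f f≡0 = cong (λ s → f 0 ℤ.+ s) (∑ℤ-extend n d (f ∘ suc) (λ i n≤i → f≡0 (suc i) (s≤s n≤i)))

aSummand : ℕ → ℕ → ℤ
aSummand n i = sign i ℤ.* ℤ.+ (i !) ℤ.* ℤ.+ c n (suc i)

a-∑ : ∀ n → a n ≡ ∑ℤ[ i < n ] aSummand n (toℕ i)
a-∑ n = Σ[1⋯]-as-∑ℤ n (λ k → sign (k ∸ 1) ℤ.* ℤ.+ ((k ∸ 1) !) ℤ.* ℤ.+ c n k)

a-∑-beyond : ∀ {n N} → n ≤ N → a n ≡ ∑ℤ[ i < N ] aSummand n (toℕ i)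
a-∑-beyond {n} {N} n≤N = begin
  a n                                    ≡⟨ a-∑ n ⟩
  ∑ℤ[ i < n ] aSummand n (toℕ i)         ≡⟨ ∑ℤ-extend n (N ∸ n) (aSummand n) vanishes ⟨
  ∑ℤ[ i < n + (N ∸ n) ] aSummand n (toℕ i) ≡⟨ cong (λ M → ∑ℤ[ i < M ] aSummand n (toℕ i)) (m+[n∸m]≡n n≤N) ⟩
  ∑ℤ[ i < N ] aSummand n (toℕ i)         ∎
  where
  vanishes : ∀ i → n ≤ i → aSummand n i ≡ ℤ.+ 0
  vanishes i n≤i = trans (cong (λ x → sign i ℤ.* ℤ.+ (i !) ℤ.* ℤ.+ x) (c-vanishes (s≤s n≤i)))
                         (ℤ.*-zeroʳ (sign i ℤ.* ℤ.+ (i !)))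

neg-aSummand-suc : ∀ m i → ℤ.- aSummand (suc m) (suc i) ≡ ∑ℤ[ t < m ] (ℤ.+ coeff m (toℕ t) ℤ.* aSummand (suc (toℕ t)) i)
neg-aSummand-suc m i = begin
  ℤ.- (ℤ.- s ℤ.* ℤ.+ (suc i * i !) ℤ.* x)
    ≡⟨ cong (λ y → ℤ.- (ℤ.- s ℤ.* y ℤ.* x)) (ℤ.pos-* (suc i) (i !)) ⟩
  ℤ.- (ℤ.- s ℤ.* (ℤ.+ suc i ℤ.* ℤ.+ (i !)) ℤ.* x)
    ≡⟨ regroup s (ℤ.+ suc i) (ℤ.+ (i !)) x ⟩
  s ℤ.* ℤ.+ (i !) ℤ.* (ℤ.+ suc i ℤ.* x)
    ≡⟨ cong (λ y → s ℤ.* ℤ.+ (i !) ℤ.* y) (sym (ℤ.pos-* (suc i) _)) ⟩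
  s ℤ.* ℤ.+ (i !) ℤ.* ℤ.+ (suc i * c (suc m) (2 + i))
    ≡⟨ cong (λ y → s ℤ.* ℤ.+ (i !) ℤ.* ℤ.+ y) (k*c[1+m,1+k]≡∑coeff*c m (suc i)) ⟩
  s ℤ.* ℤ.+ (i !) ℤ.* ℤ.+ (∑[ t < m ] (coeff m (toℕ t) * c (suc (toℕ t)) (suc i)))
    ≡⟨ cong (λ y → s ℤ.* ℤ.+ (i !) ℤ.* y) (pos-∑ m _) ⟩
  s ℤ.* ℤ.+ (i !) ℤ.* ∑ℤ[ t < m ] (ℤ.+ (coeff m (toℕ t) * c (suc (toℕ t)) (suc i)))
    ≡⟨ ℤΣ.*-distribˡ-sum {m} (s ℤ.* ℤ.+ (i !)) (λ t → ℤ.+ (coeff m (toℕ t) * c (suc (toℕ t)) (suc i))) ⟩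
  ∑ℤ[ t < m ] (s ℤ.* ℤ.+ (i !) ℤ.* ℤ.+ (coeff m (toℕ t) * c (suc (toℕ t)) (suc i)))
    ≡⟨ ℤΣ.sum-cong-≗ {m} (pull ∘ toℕ) ⟩
  ∑ℤ[ t < m ] (ℤ.+ coeff m (toℕ t) ℤ.* aSummand (suc (toℕ t)) i) ∎
  where
  s = sign i
  x = ℤ.+ c (suc m) (2 + i)
  regroup : ∀ s j f x → ℤ.- (ℤ.- s ℤ.* (j ℤ.* f) ℤ.* x) ≡ s ℤ.* f ℤ.* (j ℤ.* x)
  regroup = ℤ-Solver.solve-∀
  swap : ∀ s f b x → s ℤ.* f ℤ.* (b ℤ.* x) ≡ b ℤ.* (s ℤ.* f ℤ.* x)
  swap = ℤ-Solver.solve-∀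
  pull : ∀ t → s ℤ.* ℤ.+ (i !) ℤ.* ℤ.+ (coeff m t * c (suc t) (suc i)) ≡ ℤ.+ coeff m t ℤ.* aSummand (suc t) i
  pull t = trans (cong (λ y → s ℤ.* ℤ.+ (i !) ℤ.* y) (ℤ.pos-* (coeff m t) (c (suc t) (suc i))))
                 (swap s (ℤ.+ (i !)) (ℤ.+ coeff m t) (ℤ.+ c (suc t) (suc i)))

m!-a[1+m]≡∑neg-aSummand : ∀ m → ℤ.+ (m !) ℤ.- a (suc m) ≡ ∑ℤ[ i < m ] (ℤ.- aSummand (suc m) (suc (toℕ i)))
m!-a[1+m]≡∑neg-aSummand m = begin
  ℤ.+ (m !) ℤ.- a (suc m)
    ≡⟨ cong (λ y → ℤ.+ (m !) ℤ.- y) (a-∑ (suc m)) ⟩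
  ℤ.+ (m !) ℤ.- (aSummand (suc m) 0 ℤ.+ ∑ℤ[ i < m ] aSummand (suc m) (suc (toℕ i)))
    ≡⟨ cong (λ y → ℤ.+ (m !) ℤ.- (y ℤ.+ ∑ℤ[ i < m ] aSummand (suc m) (suc (toℕ i)))) aSummand[1+m,0]≡m! ⟩
  ℤ.+ (m !) ℤ.- (ℤ.+ (m !) ℤ.+ ∑ℤ[ i < m ] aSummand (suc m) (suc (toℕ i)))
    ≡⟨ cancel (ℤ.+ (m !)) _ ⟩
  ℤ.- ∑ℤ[ i < m ] aSummand (suc m) (suc (toℕ i))
    ≡⟨ neg-∑ m _ ⟩
  ∑ℤ[ i < m ] (ℤ.- aSummand (suc m) (suc (toℕ i))) ∎
  where
  aSummand[1+m,0]≡m! : aSummand (suc m) 0 ≡ ℤ.+ (m !)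
  aSummand[1+m,0]≡m! = trans (ℤ.*-identityˡ _) (cong ℤ.+_ (c-suc-one m))
  cancel : ∀ x y → x ℤ.- (x ℤ.+ y) ≡ ℤ.- y
  cancel = ℤ-Solver.solve-∀

∑neg-aSummand≡∑coeff*a : ∀ m → ∑ℤ[ i < m ] (ℤ.- aSummand (suc m) (suc (toℕ i)))
                              ≡ ∑ℤ[ t < m ] (ℤ.+ coeff m (toℕ t) ℤ.* a (suc (toℕ t)))
∑neg-aSummand≡∑coeff*a m = begin
  ∑ℤ[ i < m ] (ℤ.- aSummand (suc m) (suc (toℕ i)))
    ≡⟨ ℤΣ.sum-cong-≗ {m} (λ i → neg-aSummand-suc m (toℕ i)) ⟩
  ∑ℤ[ i < m ] ∑ℤ[ t < m ] (ℤ.+ coeff m (toℕ t) ℤ.* aSummand (suc (toℕ t)) (toℕ i))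
    ≡⟨ ℤΣ.∑-comm {m} {m} (λ i t → ℤ.+ coeff m (toℕ t) ℤ.* aSummand (suc (toℕ t)) (toℕ i)) ⟩
  ∑ℤ[ t < m ] ∑ℤ[ i < m ] (ℤ.+ coeff m (toℕ t) ℤ.* aSummand (suc (toℕ t)) (toℕ i))
    ≡⟨ ℤΣ.sum-cong-≗ {m} (λ t → ℤΣ.*-distribˡ-sum {m} (ℤ.+ coeff m (toℕ t)) (aSummand (suc (toℕ t)) ∘ toℕ)) ⟨
  ∑ℤ[ t < m ] (ℤ.+ coeff m (toℕ t) ℤ.* ∑ℤ[ i < m ] aSummand (suc (toℕ t)) (toℕ i))
    ≡⟨ ℤΣ.sum-cong-≗ {m} (λ t → cong (λ y → ℤ.+ coeff m (toℕ t) ℤ.* y) (a-∑-beyond (toℕ<n t))) ⟨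
  ∑ℤ[ t < m ] (ℤ.+ coeff m (toℕ t) ℤ.* a (suc (toℕ t))) ∎

mainTheorem12 : ∀ (m : ℕ) → let n = suc m in
    ℤ.+ ((n ∸ 1) !) ℤ.- a n ≡ Σ[ 1 ⋯ n ∸ 1 ] (λ k → ℤ.+ ((n ∸ 1) C (k ∸ 1)) ℤ.* ℤ.+ ((n ∸ k ∸ 1) !) ℤ.* a k)
mainTheorem12 m = begin
  ℤ.+ (m !) ℤ.- a (suc m)
    ≡⟨ m!-a[1+m]≡∑neg-aSummand m ⟩
  ∑ℤ[ i < m ] (ℤ.- aSummand (suc m) (suc (toℕ i)))
    ≡⟨ ∑neg-aSummand≡∑coeff*a m ⟩
  ∑ℤ[ t < m ] (ℤ.+ coeff m (toℕ t) ℤ.* a (suc (toℕ t)))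
    ≡⟨ ℤΣ.sum-cong-≗ {m} (λ t → cong (λ y → y ℤ.* a (suc (toℕ t))) (ℤ.pos-* (m C toℕ t) _)) ⟩
  ∑ℤ[ t < m ] (ℤ.+ (m C toℕ t) ℤ.* ℤ.+ ((m ∸ toℕ t ∸ 1) !) ℤ.* a (suc (toℕ t)))
    ≡⟨ Σ[1⋯]-as-∑ℤ m (λ k → ℤ.+ (m C (k ∸ 1)) ℤ.* ℤ.+ ((suc m ∸ k ∸ 1) !) ℤ.* a k) ⟨
  Σ[ 1 ⋯ m ] (λ k → ℤ.+ (m C (k ∸ 1)) ℤ.* ℤ.+ ((suc m ∸ k ∸ 1) !) ℤ.* a k) ∎
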